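{- The Weihrauch problem $\mathsf{P}$ of finding a connected component of a countable graph is strongly Weihrauch equivalent to its binary parallelization $\langle\mathsf{P},\mathsf{P}\rangle$.
   Context: A Weihrauch problem is a set $\mathsf{C}\subseteq 2^\omega\times 2^\omega$ of instance/solution pairs. $\mathsf{Q}\le_{\mathrm{sW}}\mathsf{R}$ (strong Weihrauch reducibility) means there are Turing functionals $\Phi,\Psi$ such that for every instance $A$ of $\mathsf{Q}$, $\Phi(A)$ is an instance of $\mathsf{R}$ and for every solution $T$ of $\Phi(A)$, $\Psi(T)$ is a solution of $A$; equivalence means reducibility both ways. $\mathsf{P}$: an instance is a countable graph $(V,E)$ ($V$ a nonempty infinite subset of $\mathbb{N}$, $E$ a set of unordered pairs from $V$); a solution is a connected component, i.e. a set $C\subseteq V$ any two elements of which are joined by a finite path and such that if $x\in C$ and $y$ is path connected to $x$ then $y\in C$. $\langle\mathsf{P},\mathsf{P}\rangle$: an instance is a pair of countable graphs $(G_1,G_2)$, a solution is a pair $(C_1,C_2)$ with $C_i$ a connected component of $G_i$. -}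

module Defs where

open import Data.Nat using (ℕ; zero; suc; _+_; _*_; _≤_; _<_)
open import Data.Nat.Properties using ()
open import Data.Fin using (Fin)
open import Data.Vec using (Vec; []; _∷_; lookup)
open import Data.Bool using (Bool; true; false; if_then_else_)
open import Data.Product using (Σ; ∃; _×_; _,_)
open import Relation.Binary.PropositionalEquality using (_≡_; _≢_)

Cantor : Set
Cantor = ℕ → Bool

record Problem : Set₁ where
  field
    Inst : Cantor → Set
    Sol  : Cantor → Cantor → Set
open Problem public

-- Turing functionals: oracle partial recursive functions (Kleene),
-- with the oracle queried by the basic function `orc`.

data Prog : ℕ → Set where
  zer  : ∀ {n} → Prog n
  sucP : Prog 1
  proj : ∀ {n} → Fin n → Prog n
  orc  : Prog 1
  comp : ∀ {m n} → Prog m → Vec (Prog n) m → Prog n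
  prec : ∀ {n} → Prog n → Prog (suc (suc n)) → Prog (suc n)
  mu   : ∀ {n} → Prog (suc n) → Prog n

bit : Bool → ℕ
bit true  = 1
bit false = 0

mutual
  data Eval (A : Cantor) : ∀ {n} → Prog n → Vec ℕ n → ℕ → Set where
    e-zer  : ∀ {n} {xs : Vec ℕ n} → Eval A zer xs 0
    e-suc  : ∀ {x} → Eval A sucP (x ∷ []) (suc x)
    e-proj : ∀ {n} {i : Fin n} {xs} → Eval A (proj i) xs (lookup xs i)
    e-orc  : ∀ {x} → Eval A orc (x ∷ []) (bit (A x))
    e-comp : ∀ {m n} {f : Prog m} {gs : Vec (Prog n) m} {xs ys v} →
             EvalAll A gs xs ys → Eval A f ys v → Eval A (comp f gs) xs v
    e-prec0 : ∀ {n} {g : Prog n} {h} {xs v} →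
              Eval A g xs v → Eval A (prec g h) (0 ∷ xs) v
    e-precS : ∀ {n} {g : Prog n} {h} {k xs r v} →
              Eval A (prec g h) (k ∷ xs) r → Eval A h (k ∷ r ∷ xs) v →
              Eval A (prec g h) (suc k ∷ xs) v
    e-mu   : ∀ {n} {f : Prog (suc n)} {xs y} →
             Eval A f (y ∷ xs) 0 →
             (∀ z → z < y → ∃ λ k → Eval A f (z ∷ xs) (suc k)) →
             Eval A (mu f) xs y

  data EvalAll (A : Cantor) {n : ℕ} : ∀ {m} → Vec (Prog n) m → Vec ℕ n → Vec ℕ m → Set where
    []  : ∀ {xs} → EvalAll A [] xs []
    _∷_ : ∀ {m} {g : Prog n} {gs : Vec (Prog n) m} {xs y ys} →
          Eval A g xs y → EvalAll A gs xs ys → EvalAll A (g ∷ gs) xs (y ∷ ys)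

-- A Turing functional is a unary oracle program; Φ^A = X means that Φ
-- with oracle A is total and outputs the characteristic function of X.
Functional : Set
Functional = Prog 1

_⟦_⟧≡_ : Functional → Cantor → Cantor → Set
Φ ⟦ A ⟧≡ X = ∀ n → Eval A Φ (n ∷ []) (bit (X n))

_≤sW_ : Problem → Problem → Set
Q ≤sW R = Σ Functional λ Φ → Σ Functional λ Ψ →
  ∀ A → Inst Q A →
    Σ Cantor λ B → (Φ ⟦ A ⟧≡ B) × Inst R B ×
      (∀ T → Sol R B T → Σ Cantor λ S → (Ψ ⟦ T ⟧≡ S) × Sol Q A S)

_≡sW_ : Problem → Problem → Set
Q ≡sW R = (Q ≤sW R) × (R ≤sW Q)

-- Cantor pairing ⟨x,y⟩ = (x+y)(x+y+1)/2 + y, via triangular numbers.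
tri : ℕ → ℕ
tri zero    = zero
tri (suc k) = suc k + tri k

pair : ℕ → ℕ → ℕ
pair x y = tri (x + y) + y

Vtx : Cantor → ℕ → Set
Vtx A x = A (2 * x) ≡ true

Edge : Cantor → ℕ → ℕ → Set
Edge A x y = A (suc (2 * pair x y)) ≡ true

IsGraph : Cantor → Set
IsGraph A =
  (∃ λ x → Vtx A x) ×
  (∀ n → ∃ λ m → n ≤ m × Vtx A m) ×
  (∀ x y → Edge A x y → Vtx A x × Vtx A y) ×
  (∀ x y → Edge A x y → Edge A y x) ×
  (∀ x y → Edge A x y → x ≢ y)

data Conn (A : Cantor) : ℕ → ℕ → Set where
  here : ∀ {x} → Vtx A x → Conn A x x
  step : ∀ {x y z} → Edge A x y → Conn A y z → Conn A x z

Mem : Cantor → ℕ → Set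
Mem C x = C x ≡ true

IsComponent : Cantor → Cantor → Set
IsComponent A C =
  (∃ λ x → Mem C x) ×
  (∀ x → Mem C x → Vtx A x) ×
  (∀ x y → Mem C x → Mem C y → Conn A x y) ×
  (∀ x y → Mem C x → Conn A x y → Mem C y)

P : Problem
P = record { Inst = IsGraph ; Sol = IsComponent }

left right : Cantor → Cantor
left  A n = A (2 * n)
right A n = A (suc (2 * n))

⟨_,_⟩ : Problem → Problem → Problem
⟨ Q , R ⟩ = record
  { Inst = λ A → Inst Q (left A) × Inst R (right A)
  ; Sol  = λ A T → Sol Q (left A) (left T) × Sol R (right A) (right T) }

-- One direction is trivial: hand the graph G to both coordinates, solve ⟨P,P⟩ on
-- (G, G) and keep the first component. For the other, a pair of graphs (G, H) is
-- sent to its Cartesian product G □ H, whose vertices are the pairs ⟨x,y⟩ and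
-- whose edges move one coordinate along an edge while the other stays fixed.
-- The connected components of G □ H are exactly the products C₁ × C₂ of
-- components, so from a component C of G □ H and any z ∈ C (the least one, found
-- by unbounded search) the row and the column of C through z are components of G
-- and of H.
module Submission where

open import Data.Bool using (Bool; true; false; not; _∧_; _∨_; if_then_else_)
open import Data.Bool.Properties using (∨-identityʳ; not-involutive; T-≡)
open import Data.Fin using (Fin; zero; suc; #_)
open import Data.Nat using (ℕ; zero; suc; _+_; _*_; _∸_; pred; _≤_; _<_; _≡ᵇ_; _≤ᵇ_; z≤n; s≤s; z<s)
open import Data.Nat.Properties
open import Data.Product using (∃; _×_; _,_; proj₁; proj₂)
open import Data.Sum using (_⊎_; inj₁; inj₂; [_,_]′)
open import Data.Vec using (Vec; []; _∷_; lookup)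
open import Function using (_∘_; id; const; _⇔_; mk⇔; Equivalence)
open import Function.Construct.Composition using (_⇔-∘_)
open import Relation.Binary.PropositionalEquality
open import Relation.Nullary.Reflects using (ofʸ; ofⁿ)

open import Defs

open Equivalence using (to; from)

private variable
  A C D G H X Y : Cantor
  n : ℕ

Computes : Cantor → Prog n → (Vec ℕ n → ℕ) → Set
Computes A p f = ∀ xs → Eval A p xs (f xs)

-- Unary and binary specifications are stated pointwise, so that unification can
-- recover f from a goal.
Computes₁ : Cantor → Prog 1 → (ℕ → ℕ) → Set
Computes₁ A p f = ∀ x → Eval A p (x ∷ []) (f x)

Computes₂ : Cantor → Prog 2 → (ℕ → ℕ → ℕ) → Set
Computes₂ A p f = ∀ x y → Eval A p (x ∷ y ∷ []) (f x y)

computes₁ : ∀ {p f} → Computes A p (λ xs → f (lookup xs zero)) → Computes₁ A p f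
computes₁ p! x = p! (x ∷ [])

computes₂ : ∀ {p f} → Computes A p (λ xs → f (lookup xs zero) (lookup xs (suc zero))) → Computes₂ A p f
computes₂ p! x y = p! (x ∷ y ∷ [])

Decides : Cantor → Prog n → (Vec ℕ n → Bool) → Set
Decides A p a = Computes A p (bit ∘ a)

⟦⟧≡-≗ : ∀ {p} → X ≗ Y → p ⟦ A ⟧≡ X → p ⟦ A ⟧≡ Y
⟦⟧≡-≗ X≗Y p! x = subst (Eval _ _ (x ∷ [])) (cong bit (X≗Y x)) (p! x)

Computes-≗ : ∀ {p f g} → f ≗ g → Computes {n} A p f → Computes A p g
Computes-≗ f≗g p! xs = subst (Eval _ _ xs) (f≗g xs) (p! xs)

Decides-≗ : ∀ {p a b} → a ≗ b → Decides {n} A p a → Decides A p b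
Decides-≗ a≗b = Computes-≗ (cong bit ∘ a≗b)

infixr 9 _∙_
_∙_ : Prog 1 → Prog n → Prog n
f ∙ p = comp f (p ∷ [])

_∙⟨_,_⟩ : Prog 2 → Prog n → Prog n → Prog n
f ∙⟨ p , q ⟩ = comp f (p ∷ q ∷ [])

∙-computes : ∀ {f g p h} → Computes₁ A f g → Computes {n} A p h → Computes A (f ∙ p) (g ∘ h)
∙-computes f! p! xs = e-comp (p! xs ∷ []) (f! _)

∙⟨⟩-computes : ∀ {f g p h q k} → Computes₂ A f g → Computes {n} A p h → Computes A q k →
               Computes A (f ∙⟨ p , q ⟩) (λ xs → g (h xs) (k xs))
∙⟨⟩-computes f! p! q! xs = e-comp (p! xs ∷ q! xs ∷ []) (f! _ _)

zer-computes : Computes A (zer {n}) (const 0)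
zer-computes _ = e-zer

suc-computes : Computes₁ A sucP suc
suc-computes _ = e-suc

proj-computes : (i : Fin n) → Computes A (proj i) (λ xs → lookup xs i)
proj-computes _ _ = e-proj

orc-decides : orc ⟦ A ⟧≡ A
orc-decides _ = e-orc

query : ∀ {p f} → Computes {n} A p f → Decides A (orc ∙ p) (A ∘ f)
query = ∙-computes orc-decides

prec-eval : ∀ {g h} (r : ℕ → Vec ℕ n → ℕ) → Computes A g (r 0) →
            (∀ k xs → Eval A h (k ∷ r k xs ∷ xs) (r (suc k) xs)) →
            ∀ k xs → Eval A (prec g h) (k ∷ xs) (r k xs)
prec-eval r g! h! zero    xs = e-prec0 (g! xs)
prec-eval r g! h! (suc k) xs = e-precS (prec-eval r g! h! k xs) (h! k xs)

prec₁-computes : ∀ {g h} (r : ℕ → ℕ) → Eval A g [] (r 0) →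
                 (∀ k → Eval A h (k ∷ r k ∷ []) (r (suc k))) → Computes₁ A (prec g h) r
prec₁-computes r g! h! k = prec-eval (λ k _ → r k) (λ { [] → g! }) (λ { k [] → h! k }) k []

prec₂-computes : ∀ {g h} (r : ℕ → ℕ → ℕ) → Computes₁ A g (r 0) →
                 (∀ k y → Eval A h (k ∷ r k y ∷ y ∷ []) (r (suc k) y)) → Computes₂ A (prec g h) r
prec₂-computes r g! h! k y =
  prec-eval (λ k ys → r k (lookup ys zero)) (λ { (y ∷ []) → g! y }) (λ { k (y ∷ []) → h! k y }) k (y ∷ [])

addₚ : Prog 2
addₚ = prec (proj zero) (sucP ∙ proj (# 1))

add-computes : Computes₂ A addₚ _+_
add-computes = prec₂-computes _+_ (λ _ → e-proj)
  (λ k y → ∙-computes suc-computes (proj-computes (# 1)) (k ∷ k + y ∷ y ∷ []))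

mulₚ : Prog 2
mulₚ = prec zer (addₚ ∙⟨ proj (# 2) , proj (# 1) ⟩)

mul-computes : Computes₂ A mulₚ _*_
mul-computes = prec₂-computes _*_ (λ _ → e-zer)
  (λ k y → ∙⟨⟩-computes add-computes (proj-computes (# 2)) (proj-computes (# 1)) (k ∷ k * y ∷ y ∷ []))

predₚ : Prog 1
predₚ = prec zer (proj zero)

pred-computes : Computes₁ A predₚ pred
pred-computes = prec₁-computes pred e-zer (λ _ → e-proj)

monusₚ : Prog 2
monusₚ = prec (proj zero) (predₚ ∙ proj (# 1)) ∙⟨ proj (# 1) , proj zero ⟩

monus-computes : Computes₂ A monusₚ _∸_
monus-computes = computes₂ (∙⟨⟩-computes downFrom (proj-computes (# 1)) (proj-computes zero))
  where
  downFrom : Computes₂ _ (prec (proj zero) (predₚ ∙ proj (# 1))) (λ k y → y ∸ k)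
  downFrom = prec₂-computes (λ k y → y ∸ k) (λ _ → e-proj) λ k y →
    subst (Eval _ _ _) (pred[m∸n]≡m∸[1+n] y k)
      (∙-computes pred-computes (proj-computes (# 1)) (k ∷ y ∸ k ∷ y ∷ []))

doubleₚ : Prog 1
doubleₚ = mulₚ ∙⟨ sucP ∙ sucP ∙ zer , proj zero ⟩

double-computes : Computes₁ A doubleₚ (2 *_)
double-computes = computes₁ (∙⟨⟩-computes mul-computes
  (∙-computes suc-computes (∙-computes suc-computes zer-computes)) (proj-computes zero))

isZeroₚ : Prog 1
isZeroₚ = prec (sucP ∙ zer) zer

isZero-computes : Computes₁ A isZeroₚ (λ m → bit (m ≡ᵇ 0))
isZero-computes = prec₁-computes (λ m → bit (m ≡ᵇ 0)) (e-comp (e-zer ∷ []) e-suc) (λ _ → e-zer)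

isZero-decides : ∀ {p f} → Computes {n} A p f → Decides A (isZeroₚ ∙ p) (λ xs → f xs ≡ᵇ 0)
isZero-decides = ∙-computes isZero-computes

bit≡ᵇ0 : ∀ b → (bit b ≡ᵇ 0) ≡ not b
bit≡ᵇ0 true  = refl
bit≡ᵇ0 false = refl

not-decides : ∀ {p a} → Decides {n} A p a → Decides A (isZeroₚ ∙ p) (not ∘ a)
not-decides {a = a} p! = Decides-≗ (bit≡ᵇ0 ∘ a) (isZero-decides p!)

infix  8 _≡ᵇₚ_ _≤ᵇₚ_
infixr 7 _∧ₚ_
infixr 6 _∨ₚ_

_∧ₚ_ : Prog n → Prog n → Prog n
p ∧ₚ q = mulₚ ∙⟨ p , q ⟩

bit-∧ : ∀ a b → bit a * bit b ≡ bit (a ∧ b)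
bit-∧ true  true  = refl
bit-∧ true  false = refl
bit-∧ false _     = refl

∧-decides : ∀ {p a q b} → Decides {n} A p a → Decides A q b → Decides A (p ∧ₚ q) (λ xs → a xs ∧ b xs)
∧-decides {a = a} {b = b} p! q! =
  Computes-≗ (λ xs → bit-∧ (a xs) (b xs)) (∙⟨⟩-computes mul-computes p! q!)

_∨ₚ_ : Prog n → Prog n → Prog n
p ∨ₚ q = isZeroₚ ∙ isZeroₚ ∙ addₚ ∙⟨ p , q ⟩

not[bit+bit≡ᵇ0] : ∀ a b → not (bit a + bit b ≡ᵇ 0) ≡ a ∨ b
not[bit+bit≡ᵇ0] true  _     = refl
not[bit+bit≡ᵇ0] false true  = refl
not[bit+bit≡ᵇ0] false false = refl

∨-decides : ∀ {p a q b} → Decides {n} A p a → Decides A q b → Decides A (p ∨ₚ q) (λ xs → a xs ∨ b xs)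
∨-decides {a = a} {b = b} p! q! =
  Decides-≗ (λ xs → not[bit+bit≡ᵇ0] (a xs) (b xs))
    (not-decides (isZero-decides (∙⟨⟩-computes add-computes p! q!)))

infix 0 ifₚ_then_else_
ifₚ_then_else_ : Prog n → Prog n → Prog n → Prog n
ifₚ c then p else q = c ∧ₚ p ∨ₚ (isZeroₚ ∙ c) ∧ₚ q

if-as-∧∨ : ∀ c a b → (c ∧ a ∨ not c ∧ b) ≡ (if c then a else b)
if-as-∧∨ true  a _ = ∨-identityʳ a
if-as-∧∨ false _ _ = refl

if-decides : ∀ {c γ p a q b} → Decides {n} A c γ → Decides A p a → Decides A q b →
             Decides A (ifₚ c then p else q) (λ xs → if γ xs then a xs else b xs)
if-decides {γ = γ} {a = a} {b = b} c! p! q! =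
  Decides-≗ (λ xs → if-as-∧∨ (γ xs) (a xs) (b xs))
    (∨-decides (∧-decides c! p!) (∧-decides (not-decides c!) q!))

_≡ᵇₚ_ : Prog n → Prog n → Prog n
p ≡ᵇₚ q = isZeroₚ ∙ addₚ ∙⟨ monusₚ ∙⟨ p , q ⟩ , monusₚ ∙⟨ q , p ⟩ ⟩

∸+∸≡ᵇ0 : ∀ x y → (x ∸ y + (y ∸ x) ≡ᵇ 0) ≡ (x ≡ᵇ y)
∸+∸≡ᵇ0 zero    zero    = refl
∸+∸≡ᵇ0 zero    (suc y) = refl
∸+∸≡ᵇ0 (suc x) zero    = refl
∸+∸≡ᵇ0 (suc x) (suc y) = ∸+∸≡ᵇ0 x y

≡ᵇ-decides : ∀ {p f q g} → Computes {n} A p f → Computes A q g →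
             Decides A (p ≡ᵇₚ q) (λ xs → f xs ≡ᵇ g xs)
≡ᵇ-decides {f = f} {g = g} p! q! =
  Decides-≗ (λ xs → ∸+∸≡ᵇ0 (f xs) (g xs))
    (isZero-decides (∙⟨⟩-computes add-computes (∙⟨⟩-computes monus-computes p! q!)
                                                (∙⟨⟩-computes monus-computes q! p!)))

_≤ᵇₚ_ : Prog n → Prog n → Prog n
p ≤ᵇₚ q = isZeroₚ ∙ monusₚ ∙⟨ p , q ⟩

∸≡ᵇ0 : ∀ x y → (x ∸ y ≡ᵇ 0) ≡ (x ≤ᵇ y)
∸≡ᵇ0 zero          zero    = refl
∸≡ᵇ0 zero          (suc y) = refl
∸≡ᵇ0 (suc x)       zero    = refl
∸≡ᵇ0 (suc zero)    (suc y) = ∸≡ᵇ0 zero y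
∸≡ᵇ0 (suc (suc x)) (suc y) = ∸≡ᵇ0 (suc x) y

≤ᵇ-decides : ∀ {p f q g} → Computes {n} A p f → Computes A q g →
             Decides A (p ≤ᵇₚ q) (λ xs → f xs ≤ᵇ g xs)
≤ᵇ-decides {f = f} {g = g} p! q! =
  Decides-≗ (λ xs → ∸≡ᵇ0 (f xs) (g xs)) (isZero-decides (∙⟨⟩-computes monus-computes p! q!))

Least : Cantor → ℕ → Set
Least C z = Mem C z × (∀ y → y < z → C y ≡ false)

least-or-empty-below : ∀ C n → ∃ (Least C) ⊎ (∀ y → y < n → C y ≡ false)
least-or-empty-below C zero = inj₂ λ _ ()
least-or-empty-below C (suc n) with least-or-empty-below C n
... | inj₁ least = inj₁ least
... | inj₂ empty with C n in Cn≡
...   | true  = inj₁ (n , Cn≡ , empty)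
...   | false = inj₂ λ y y<1+n → [ empty y , (λ { refl → Cn≡ }) ]′ (m<1+n⇒m<n∨m≡n y<1+n)

least-exists : ∀ {z} → Mem C z → ∃ (Least C)
least-exists {C} {z} Cz with least-or-empty-below C (suc z)
... | inj₁ least = least
... | inj₂ empty with () ← trans (sym Cz) (empty z ≤-refl)

leastₚ : Prog n
leastₚ = mu (isZeroₚ ∙ orc ∙ proj zero)

leastₚ-computes : ∀ {z} → Least C z → Computes C (leastₚ {n}) (const z)
leastₚ-computes {C} (Cz , below) xs = e-mu (probe Cz) (λ y y<z → 0 , probe (below y y<z))
  where
  probe : ∀ {y b} → C y ≡ b → Eval C (isZeroₚ ∙ orc ∙ proj zero) (y ∷ xs) (bit (not b))
  probe {y} refl = not-decides (query (proj-computes zero)) (y ∷ xs)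

odd : ℕ → Bool
odd zero    = false
odd (suc n) = not (odd n)

half : ℕ → ℕ
half zero    = 0
half (suc n) = half n + bit (odd n)

odd-suc-suc : ∀ m → odd (suc (suc m)) ≡ odd m
odd-suc-suc m = not-involutive (odd m)

bit+bit∘not : ∀ b → bit b + bit (not b) ≡ 1
bit+bit∘not true  = refl
bit+bit∘not false = refl

half-suc-suc : ∀ m → half (suc (suc m)) ≡ suc (half m)
half-suc-suc m = trans (+-assoc (half m) _ _)
  (trans (cong (half m +_) (bit+bit∘not (odd m))) (+-comm (half m) 1))

odd-double : ∀ n → odd (2 * n) ≡ false
odd-double zero    = refl
odd-double (suc n) = trans (cong odd (*-suc 2 n)) (trans (odd-suc-suc (2 * n)) (odd-double n))

half-double : ∀ n → half (2 * n) ≡ n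
half-double zero    = refl
half-double (suc n) =
  trans (cong half (*-suc 2 n)) (trans (half-suc-suc (2 * n)) (cong suc (half-double n)))

half-suc-double : ∀ n → half (suc (2 * n)) ≡ n
half-suc-double n rewrite odd-double n | half-double n = +-identityʳ n

_⊕_ : Cantor → Cantor → Cantor
(X ⊕ Y) n = if odd n then Y (half n) else X (half n)

left-⊕ : ∀ X Y → left (X ⊕ Y) ≗ X
left-⊕ X Y n = trans (cong (λ b → if b then Y (half (2 * n)) else X (half (2 * n))) (odd-double n))
                     (cong X (half-double n))

right-⊕ : ∀ X Y → right (X ⊕ Y) ≗ Y
right-⊕ X Y n =
  trans (cong (λ b → if not b then Y (half (suc (2 * n))) else X (half (suc (2 * n)))) (odd-double n))
        (cong Y (half-suc-double n))

oddₚ : Prog 1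
oddₚ = prec zer (isZeroₚ ∙ proj (# 1))

odd-decides : oddₚ ⟦ A ⟧≡ odd
odd-decides = prec₁-computes (bit ∘ odd) e-zer λ k →
  subst (Eval _ _ _) (cong bit (bit≡ᵇ0 (odd k)))
    (isZero-decides (proj-computes (# 1)) (k ∷ bit (odd k) ∷ []))

halfₚ : Prog 1
halfₚ = prec zer (addₚ ∙⟨ proj (# 1) , oddₚ ∙ proj zero ⟩)

half-computes : Computes₁ A halfₚ half
half-computes = prec₁-computes half e-zer λ k →
  ∙⟨⟩-computes add-computes (proj-computes (# 1)) (∙-computes odd-decides (proj-computes zero))
    (k ∷ half k ∷ [])

infixr 5 _⊕ₚ_
_⊕ₚ_ : Prog 1 → Prog 1 → Prog 1
p ⊕ₚ q = ifₚ oddₚ ∙ proj zero then q ∙ halfₚ ∙ proj zero else p ∙ halfₚ ∙ proj zero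

⊕-decides : ∀ {p q} → p ⟦ A ⟧≡ X → q ⟦ A ⟧≡ Y → (p ⊕ₚ q) ⟦ A ⟧≡ (X ⊕ Y)
⊕-decides p! q! = computes₁ (if-decides (∙-computes odd-decides (proj-computes zero))
  (∙-computes q! (∙-computes half-computes (proj-computes zero)))
  (∙-computes p! (∙-computes half-computes (proj-computes zero))))

tri-mono : ∀ {m n} → m ≤ n → tri m ≤ tri n
tri-mono z≤n       = z≤n
tri-mono (s≤s m≤n) = +-mono-≤ (s≤s m≤n) (tri-mono m≤n)

n≤tri : ∀ n → n ≤ tri n
n≤tri zero    = z≤n
n≤tri (suc n) = m≤m+n (suc n) (tri n)

≤-pair : ∀ x y → x ≤ pair x y
≤-pair x y = ≤-trans (m≤m+n x y) (≤-trans (n≤tri (x + y)) (m≤m+n (tri (x + y)) y))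

-- n = ⟨x,y⟩ lies on the d-th antidiagonal x + y = d.
OnDiagonal : ℕ → ℕ → Set
OnDiagonal n d = tri d ≤ n × n < tri (suc d)

onDiagonal-unique : ∀ {n d e} → OnDiagonal n d → OnDiagonal n e → d ≡ e
onDiagonal-unique d-diag e-diag = ≤-antisym (below d-diag e-diag) (below e-diag d-diag)
  where
  below : ∀ {n d e} → OnDiagonal n d → OnDiagonal n e → d ≤ e
  below (tri-d≤n , _) (_ , n<tri-e+1) =
    ≮⇒≥ λ e<d → <-irrefl refl (<-≤-trans n<tri-e+1 (≤-trans (tri-mono e<d) tri-d≤n))

onDiagonal-pair : ∀ x y → OnDiagonal (pair x y) (x + y)
onDiagonal-pair x y = m≤m+n (tri (x + y)) y ,
  subst (pair x y <_) (+-comm (tri (x + y)) (suc (x + y))) (+-monoʳ-< (tri (x + y)) (s≤s (m≤n+m y x)))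

onDiagonal-suc : ∀ {n d} → OnDiagonal n d → OnDiagonal (suc n) (d + bit (tri (suc d) ≤ᵇ suc n))
onDiagonal-suc {n} {d} (tri-d≤n , n<tri-d+1)
  with tri (suc d) ≤ᵇ suc n | ≤ᵇ-reflects-≤ (tri (suc d)) (suc n)
... | true  | ofʸ reached  =
  subst (OnDiagonal (suc n)) (+-comm 1 d) (reached , ≤-<-trans n<tri-d+1 (m<n+m (tri (suc d)) {suc (suc d)} z<s))
... | false | ofⁿ ¬reached =
  subst (OnDiagonal (suc n)) (sym (+-identityʳ d)) (m≤n⇒m≤1+n tri-d≤n , ≰⇒> ¬reached)

diag : ℕ → ℕ
diag zero    = 0
diag (suc n) = diag n + bit (tri (suc (diag n)) ≤ᵇ suc n)

diag-onDiagonal : ∀ n → OnDiagonal n (diag n)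
diag-onDiagonal zero    = z≤n , s≤s z≤n
diag-onDiagonal (suc n) = onDiagonal-suc {d = diag n} (diag-onDiagonal n)

unpair₁ unpair₂ : ℕ → ℕ
unpair₂ n = n ∸ tri (diag n)
unpair₁ n = diag n ∸ unpair₂ n

diag-pair : ∀ x y → diag (pair x y) ≡ x + y
diag-pair x y = onDiagonal-unique (diag-onDiagonal (pair x y)) (onDiagonal-pair x y)

unpair₂-pair : ∀ x y → unpair₂ (pair x y) ≡ y
unpair₂-pair x y rewrite diag-pair x y = m+n∸m≡n (tri (x + y)) y

unpair₁-pair : ∀ x y → unpair₁ (pair x y) ≡ x
unpair₁-pair x y rewrite unpair₂-pair x y | diag-pair x y = m+n∸n≡m x y

pair-unpair : ∀ n → pair (unpair₁ n) (unpair₂ n) ≡ n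
pair-unpair n =
  begin
    tri (diag n ∸ unpair₂ n + unpair₂ n) + unpair₂ n  ≡⟨ cong (λ d → tri d + unpair₂ n) (m∸n+n≡m y≤d) ⟩
    tri (diag n) + unpair₂ n                          ≡⟨ m+[n∸m]≡n tri-d≤n ⟩
    n
  ∎
  where
  open ≡-Reasoning
  tri-d≤n = proj₁ (diag-onDiagonal n)
  n<tri-d+1 = proj₂ (diag-onDiagonal n)
  y≤d : unpair₂ n ≤ diag n
  y≤d = ≤-pred (subst (unpair₂ n <_) (m+n∸n≡m (suc (diag n)) (tri (diag n)))
                                       (∸-monoˡ-< n<tri-d+1 tri-d≤n))

triₚ : Prog 1
triₚ = prec zer (addₚ ∙⟨ sucP ∙ proj zero , proj (# 1) ⟩)

tri-computes : Computes₁ A triₚ tri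
tri-computes = prec₁-computes tri e-zer λ k →
  ∙⟨⟩-computes add-computes (∙-computes suc-computes (proj-computes zero)) (proj-computes (# 1))
    (k ∷ tri k ∷ [])

pairₚ : Prog 2
pairₚ = addₚ ∙⟨ triₚ ∙ addₚ ∙⟨ proj zero , proj (# 1) ⟩ , proj (# 1) ⟩

pair-computes : Computes₂ A pairₚ pair
pair-computes = computes₂ (∙⟨⟩-computes add-computes
  (∙-computes tri-computes (∙⟨⟩-computes add-computes (proj-computes zero) (proj-computes (# 1))))
  (proj-computes (# 1)))

diagₚ : Prog 1
diagₚ = prec zer (addₚ ∙⟨ proj (# 1) , triₚ ∙ sucP ∙ proj (# 1) ≤ᵇₚ sucP ∙ proj zero ⟩)

diag-computes : Computes₁ A diagₚ diag
diag-computes = prec₁-computes diag e-zer λ k →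
  ∙⟨⟩-computes add-computes (proj-computes (# 1))
    (≤ᵇ-decides (∙-computes tri-computes (∙-computes suc-computes (proj-computes (# 1))))
                (∙-computes suc-computes (proj-computes zero)))
    (k ∷ diag k ∷ [])

unpair₂ₚ : Prog 1
unpair₂ₚ = monusₚ ∙⟨ proj zero , triₚ ∙ diagₚ ∙ proj zero ⟩

unpair₂-computes : Computes₁ A unpair₂ₚ unpair₂
unpair₂-computes = computes₁ (∙⟨⟩-computes monus-computes (proj-computes zero)
  (∙-computes tri-computes (∙-computes diag-computes (proj-computes zero))))

unpair₁ₚ : Prog 1
unpair₁ₚ = monusₚ ∙⟨ diagₚ ∙ proj zero , unpair₂ₚ ∙ proj zero ⟩

unpair₁-computes : Computes₁ A unpair₁ₚ unpair₁
unpair₁-computes = computes₁ (∙⟨⟩-computes monus-computes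
  (∙-computes diag-computes (proj-computes zero)) (∙-computes unpair₂-computes (proj-computes zero)))

vertexBit : Cantor → ℕ → Bool
vertexBit G x = G (2 * x)

edgeBit : Cantor → ℕ → ℕ → Bool
edgeBit G x y = G (suc (2 * pair x y))

Conn-≗ : ∀ {x y} → G ≗ H → Conn G x y → Conn H x y
Conn-≗ G≗H (here x∈V)   = here (trans (sym (G≗H _)) x∈V)
Conn-≗ G≗H (step e path) = step (trans (sym (G≗H _)) e) (Conn-≗ G≗H path)

IsGraph-≗ : G ≗ H → IsGraph G → IsGraph H
IsGraph-≗ {G} {H} G≗H ((x₀ , x₀∈V) , unbounded , ends , symmetric , irreflexive) =
  (x₀ , ⇒H x₀∈V) ,
  (λ n → let (m , n≤m , m∈V) = unbounded n in m , n≤m , ⇒H m∈V) ,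
  (λ x y e → let (x∈V , y∈V) = ends x y (⇒G e) in ⇒H x∈V , ⇒H y∈V) ,
  (λ x y e → ⇒H (symmetric x y (⇒G e))) ,
  (λ x y e → irreflexive x y (⇒G e))
  where
  ⇒H : ∀ {i} → G i ≡ true → H i ≡ true
  ⇒H = trans (sym (G≗H _))
  ⇒G : ∀ {i} → H i ≡ true → G i ≡ true
  ⇒G = trans (G≗H _)

IsComponent-≗ : G ≗ H → C ≗ D → IsComponent G C → IsComponent H D
IsComponent-≗ G≗H C≗D ((x₀ , x₀∈C) , C⊆V , connected , closed) =
  (x₀ , trans (sym (C≗D x₀)) x₀∈C) ,
  (λ x x∈D → trans (sym (G≗H _)) (C⊆V x (trans (C≗D x) x∈D))) ,
  (λ x y x∈D y∈D → Conn-≗ G≗H (connected x y (trans (C≗D x) x∈D) (trans (C≗D y) y∈D))) ,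
  (λ x y x∈D path → trans (sym (C≗D y)) (closed x y (trans (C≗D x) x∈D) (Conn-≗ (sym ∘ G≗H) path)))

□-vertexBit : Cantor → Cantor → ℕ → ℕ → Bool
□-vertexBit G H x y = vertexBit G x ∧ vertexBit H y

□-edgeBit : Cantor → Cantor → (x y x′ y′ : ℕ) → Bool
□-edgeBit G H x y x′ y′ =
  (y ≡ᵇ y′) ∧ vertexBit H y ∧ edgeBit G x x′ ∨ (x ≡ᵇ x′) ∧ vertexBit G x ∧ edgeBit H y y′

□-vertexCode : Cantor → Cantor → Cantor
□-vertexCode G H v = □-vertexBit G H (unpair₁ v) (unpair₂ v)

□-edgeCode : Cantor → Cantor → Cantor
□-edgeCode G H m =
  □-edgeBit G H (unpair₁ (unpair₁ m)) (unpair₂ (unpair₁ m)) (unpair₁ (unpair₂ m)) (unpair₂ (unpair₂ m))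

-- Opaque, so that Vtx (G □ H) v and Edge (G □ H) v w stay rigid during
-- unification; □-≗ gives access to the definition.
opaque
  _□_ : Cantor → Cantor → Cantor
  G □ H = □-vertexCode G H ⊕ □-edgeCode G H

data □-Edge (G H : Cantor) (x y x′ y′ : ℕ) : Set where
  along₁ : y ≡ y′ → Vtx H y → Edge G x x′ → □-Edge G H x y x′ y′
  along₂ : x ≡ x′ → Vtx G x → Edge H y y′ → □-Edge G H x y x′ y′

≡-true-⇔ : ∀ {a b} → a ≡ b → (a ≡ true) ⇔ (b ≡ true)
≡-true-⇔ a≡b = mk⇔ (trans (sym a≡b)) (trans a≡b)

∧-≡-true : ∀ {a b} → (a ∧ b ≡ true) ⇔ (a ≡ true × b ≡ true)
∧-≡-true {true} = mk⇔ (refl ,_) proj₂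
∧-≡-true {false} = mk⇔ (λ ()) (λ ())

≡ᵇ-≡-true : ∀ {m n} → ((m ≡ᵇ n) ≡ true) ⇔ (m ≡ n)
≡ᵇ-≡-true {m} {n} = mk⇔ (≡ᵇ⇒≡ m n ∘ from T-≡) (to T-≡ ∘ ≡⇒≡ᵇ m n)

∨-≡-true : ∀ {a b} → (a ∨ b ≡ true) ⇔ (a ≡ true ⊎ b ≡ true)
∨-≡-true {true}  = mk⇔ inj₁ (const refl)
∨-≡-true {false} = mk⇔ inj₂ [ (λ ()) , id ]′

□-edgeBit-true : ∀ {x y x′ y′} → (□-edgeBit G H x y x′ y′ ≡ true) ⇔ □-Edge G H x y x′ y′
□-edgeBit-true {G} {H} {x} {y} {x′} {y′} = mk⇔ ⇒□-Edge □-Edge⇒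
  where
  split : ∀ {a b c} → a ∧ b ∧ c ≡ true → a ≡ true × b ≡ true × c ≡ true
  split abc = let (a , bc) = to ∧-≡-true abc in a , to ∧-≡-true bc
  join : ∀ {a b c} → a ≡ true → b ≡ true → c ≡ true → a ∧ b ∧ c ≡ true
  join a b c = from ∧-≡-true (a , from ∧-≡-true (b , c))
  ⇒□-Edge : □-edgeBit G H x y x′ y′ ≡ true → □-Edge G H x y x′ y′
  ⇒□-Edge e with to ∨-≡-true e
  ... | inj₁ first  = let (y≡y′ , y∈V , e₁) = split first in along₁ (to ≡ᵇ-≡-true y≡y′) y∈V e₁
  ... | inj₂ second = let (x≡x′ , x∈V , e₂) = split second in along₂ (to ≡ᵇ-≡-true x≡x′) x∈V e₂
  □-Edge⇒ : □-Edge G H x y x′ y′ → □-edgeBit G H x y x′ y′ ≡ true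
  □-Edge⇒ (along₁ y≡y′ y∈V e₁) = from ∨-≡-true (inj₁ (join (from ≡ᵇ-≡-true y≡y′) y∈V e₁))
  □-Edge⇒ (along₂ x≡x′ x∈V e₂) = from ∨-≡-true (inj₂ (join (from ≡ᵇ-≡-true x≡x′) x∈V e₂))

opaque
  unfolding _□_

  □-≗ : G □ H ≗ □-vertexCode G H ⊕ □-edgeCode G H
  □-≗ _ = refl

Vtx-□ : ∀ {v} → Vtx (G □ H) v ⇔ (Vtx G (unpair₁ v) × Vtx H (unpair₂ v))
Vtx-□ {G} {H} {v} =
  ∧-≡-true ⇔-∘ ≡-true-⇔ (trans (□-≗ (2 * v)) (left-⊕ (□-vertexCode G H) (□-edgeCode G H) v))

Edge-□ : ∀ {v w} → Edge (G □ H) v w ⇔ □-Edge G H (unpair₁ v) (unpair₂ v) (unpair₁ w) (unpair₂ w)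
Edge-□ {G} {H} {v} {w} = □-edgeBit-true ⇔-∘ ≡-true-⇔ (begin
  (G □ H) (suc (2 * pair v w))
    ≡⟨ □-≗ (suc (2 * pair v w)) ⟩
  (□-vertexCode G H ⊕ □-edgeCode G H) (suc (2 * pair v w))
    ≡⟨ right-⊕ (□-vertexCode G H) (□-edgeCode G H) (pair v w) ⟩
  □-edgeCode G H (pair v w)
    ≡⟨ cong₂ (λ v w → □-edgeBit G H (unpair₁ v) (unpair₂ v) (unpair₁ w) (unpair₂ w))
             (unpair₁-pair v w) (unpair₂-pair v w) ⟩
  □-edgeBit G H (unpair₁ v) (unpair₂ v) (unpair₁ w) (unpair₂ w) ∎)
  where open ≡-Reasoning

Vtx-□-pair : ∀ x y → Vtx G x → Vtx H y → Vtx (G □ H) (pair x y)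
Vtx-□-pair {G} {H} x y x∈V y∈V = from (Vtx-□ {v = pair x y})
  (subst (Vtx G) (sym (unpair₁-pair x y)) x∈V , subst (Vtx H) (sym (unpair₂-pair x y)) y∈V)

Edge-□-pair : ∀ x y x′ y′ → □-Edge G H x y x′ y′ → Edge (G □ H) (pair x y) (pair x′ y′)
Edge-□-pair {G} {H} x y x′ y′ e = from (Edge-□ {v = pair x y} {pair x′ y′}) unpaired
  where
  unpaired : □-Edge G H (unpair₁ (pair x y)) (unpair₂ (pair x y)) (unpair₁ (pair x′ y′)) (unpair₂ (pair x′ y′))
  unpaired rewrite unpair₁-pair x y | unpair₂-pair x y | unpair₁-pair x′ y′ | unpair₂-pair x′ y′ = e

□-isGraph : IsGraph G → IsGraph H → IsGraph (G □ H)
□-isGraph {G} {H} ((x₀ , x₀∈V) , unbounded , endsG , symmetricG , irreflexiveG)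
                  ((y₀ , y₀∈V) , _         , endsH , symmetricH , irreflexiveH) =
  (pair x₀ y₀ , Vtx-□-pair x₀ y₀ x₀∈V y₀∈V) ,
  (λ n → let (x , n≤x , x∈V) = unbounded n in
    pair x y₀ , ≤-trans n≤x (≤-pair x y₀) , Vtx-□-pair x y₀ x∈V y₀∈V) ,
  ends , symmetric , irreflexive
  where
  ends : ∀ v w → Edge (G □ H) v w → Vtx (G □ H) v × Vtx (G □ H) w
  ends v w e with to (Edge-□ {v = v} {w}) e
  ... | along₁ y≡y′ y∈V e₁ = let (x∈V , x′∈V) = endsG (unpair₁ v) (unpair₁ w) e₁ in
    from (Vtx-□ {v = v}) (x∈V , y∈V) , from (Vtx-□ {v = w}) (x′∈V , subst (Vtx H) y≡y′ y∈V)
  ... | along₂ x≡x′ x∈V e₂ = let (y∈V , y′∈V) = endsH (unpair₂ v) (unpair₂ w) e₂ in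
    from (Vtx-□ {v = v}) (x∈V , y∈V) , from (Vtx-□ {v = w}) (subst (Vtx G) x≡x′ x∈V , y′∈V)

  symmetric : ∀ v w → Edge (G □ H) v w → Edge (G □ H) w v
  symmetric v w e with to (Edge-□ {v = v} {w}) e
  ... | along₁ y≡y′ y∈V e₁ =
    from (Edge-□ {v = w} {v})
      (along₁ (sym y≡y′) (subst (Vtx H) y≡y′ y∈V) (symmetricG (unpair₁ v) (unpair₁ w) e₁))
  ... | along₂ x≡x′ x∈V e₂ =
    from (Edge-□ {v = w} {v})
      (along₂ (sym x≡x′) (subst (Vtx G) x≡x′ x∈V) (symmetricH (unpair₂ v) (unpair₂ w) e₂))

  irreflexive : ∀ v w → Edge (G □ H) v w → v ≢ w
  irreflexive v .v e refl with to (Edge-□ {v = v} {v}) e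
  ... | along₁ _ _ e₁ = irreflexiveG (unpair₁ v) (unpair₁ v) e₁ refl
  ... | along₂ _ _ e₂ = irreflexiveH (unpair₂ v) (unpair₂ v) e₂ refl

Conn-□-proj₁ : ∀ {v w} → Conn (G □ H) v w → Conn G (unpair₁ v) (unpair₁ w)
Conn-□-proj₁ {v = v} (here v∈V) = here (proj₁ (to (Vtx-□ {v = v}) v∈V))
Conn-□-proj₁ {G} {v = v} {w} (step {y = u} e path) with to (Edge-□ {v = v} {u}) e
... | along₁ _    _ e₁ = step e₁ (Conn-□-proj₁ path)
... | along₂ x≡x′ _ _  = subst (λ x → Conn G x (unpair₁ w)) (sym x≡x′) (Conn-□-proj₁ path)

Conn-□-proj₂ : ∀ {v w} → Conn (G □ H) v w → Conn H (unpair₂ v) (unpair₂ w)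
Conn-□-proj₂ {v = v} (here v∈V) = here (proj₂ (to (Vtx-□ {v = v}) v∈V))
Conn-□-proj₂ {H = H} {v = v} {w} (step {y = u} e path) with to (Edge-□ {v = v} {u}) e
... | along₁ y≡y′ _ _  = subst (λ y → Conn H y (unpair₂ w)) (sym y≡y′) (Conn-□-proj₂ path)
... | along₂ _    _ e₂ = step e₂ (Conn-□-proj₂ path)

Conn-□-row : ∀ {x x′} y → Vtx H y → Conn G x x′ → Conn (G □ H) (pair x y) (pair x′ y)
Conn-□-row y y∈V (here {x} x∈V)        = here (Vtx-□-pair x y x∈V y∈V)
Conn-□-row y y∈V (step {x} {x″} e path) =
  step (Edge-□-pair x y x″ y (along₁ refl y∈V e)) (Conn-□-row y y∈V path)

Conn-□-column : ∀ x {y y′} → Vtx G x → Conn H y y′ → Conn (G □ H) (pair x y) (pair x y′)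
Conn-□-column x x∈V (here {y} y∈V)        = here (Vtx-□-pair x y x∈V y∈V)
Conn-□-column x x∈V (step {y} {y″} e path) =
  step (Edge-□-pair x y x y″ (along₂ refl x∈V e)) (Conn-□-column x x∈V path)

row column : Cantor → ℕ → Cantor
row    C y x = C (pair x y)
column C x y = C (pair x y)

row-isComponent : ∀ {z} → IsComponent (G □ H) C → Mem C z → IsComponent G (row C (unpair₂ z))
row-isComponent {G} {H} {C} {z} (_ , C⊆V , connected , closed) z∈C =
  (unpair₁ z , subst (Mem C) (sym (pair-unpair z)) z∈C) ,
  (λ x x∈row → subst (Vtx G) (unpair₁-pair x y) (proj₁ (to (Vtx-□ {v = pair x y}) (C⊆V _ x∈row)))) ,
  (λ x x′ x∈row x′∈row →
    subst₂ (Conn G) (unpair₁-pair x y) (unpair₁-pair x′ y) (Conn-□-proj₁ (connected _ _ x∈row x′∈row))) ,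
  (λ x x′ x∈row path → closed _ _ x∈row (Conn-□-row y y∈V path))
  where
  y = unpair₂ z
  y∈V : Vtx H y
  y∈V = proj₂ (to (Vtx-□ {v = z}) (C⊆V z z∈C))

column-isComponent : ∀ {z} → IsComponent (G □ H) C → Mem C z → IsComponent H (column C (unpair₁ z))
column-isComponent {G} {H} {C} {z} (_ , C⊆V , connected , closed) z∈C =
  (unpair₂ z , subst (Mem C) (sym (pair-unpair z)) z∈C) ,
  (λ y y∈col → subst (Vtx H) (unpair₂-pair x y) (proj₂ (to (Vtx-□ {v = pair x y}) (C⊆V _ y∈col)))) ,
  (λ y y′ y∈col y′∈col →
    subst₂ (Conn H) (unpair₂-pair x y) (unpair₂-pair x y′) (Conn-□-proj₂ (connected _ _ y∈col y′∈col))) ,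
  (λ y y′ y∈col path → closed _ _ y∈col (Conn-□-column x x∈V path))
  where
  x = unpair₁ z
  x∈V : Vtx G x
  x∈V = proj₁ (to (Vtx-□ {v = z}) (C⊆V z z∈C))

slices : Cantor → ℕ → Cantor
slices C z = row C (unpair₂ z) ⊕ column C (unpair₁ z)

slicesₚ : Prog 1
slicesₚ = orc ∙ pairₚ ∙⟨ proj zero , unpair₂ₚ ∙ leastₚ ⟩
       ⊕ₚ orc ∙ pairₚ ∙⟨ unpair₁ₚ ∙ leastₚ , proj zero ⟩

slices-decides : ∀ {z} → Least C z → slicesₚ ⟦ C ⟧≡ slices C z
slices-decides {C} {z} z-least = ⊕-decides {X = row C (unpair₂ z)} {Y = column C (unpair₁ z)}
  (computes₁ (query (∙⟨⟩-computes pair-computes (proj-computes zero) (∙-computes unpair₂-computes z!))))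
  (computes₁ (query (∙⟨⟩-computes pair-computes (∙-computes unpair₁-computes z!) (proj-computes zero))))
  where
  z! = leastₚ-computes z-least

slices-isComponent : ∀ {z} → IsComponent (G □ H) C → Mem C z →
                     IsComponent G (left (slices C z)) × IsComponent H (right (slices C z))
slices-isComponent {C = C} {z} C-component z∈C =
  IsComponent-≗ (λ _ → refl) (sym ∘ left-⊕ (row C (unpair₂ z)) (column C (unpair₁ z)))
                (row-isComponent C-component z∈C) ,
  IsComponent-≗ (λ _ → refl) (sym ∘ right-⊕ (row C (unpair₂ z)) (column C (unpair₁ z)))
                (column-isComponent C-component z∈C)

leftBitₚ rightBitₚ : Prog n → Prog n
leftBitₚ  i = orc ∙ doubleₚ ∙ i
rightBitₚ i = orc ∙ sucP ∙ doubleₚ ∙ i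

leftBit-decides : ∀ {i f} → Computes {n} A i f → Decides A (leftBitₚ i) (left A ∘ f)
leftBit-decides i! = query (∙-computes double-computes i!)

rightBit-decides : ∀ {i f} → Computes {n} A i f → Decides A (rightBitₚ i) (right A ∘ f)
rightBit-decides i! = query (∙-computes suc-computes (∙-computes double-computes i!))

vertexIndexₚ : Prog n → Prog n
vertexIndexₚ x = doubleₚ ∙ x

vertexIndex-computes : ∀ {x f} → Computes {n} A x f → Computes A (vertexIndexₚ x) (λ xs → 2 * f xs)
vertexIndex-computes = ∙-computes double-computes

edgeIndexₚ : Prog n → Prog n → Prog n
edgeIndexₚ x y = sucP ∙ doubleₚ ∙ pairₚ ∙⟨ x , y ⟩

edgeIndex-computes : ∀ {x f y g} → Computes {n} A x f → Computes A y g →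
                  Computes A (edgeIndexₚ x y) (λ xs → suc (2 * pair (f xs) (g xs)))
edgeIndex-computes x! y! =
  ∙-computes suc-computes (∙-computes double-computes (∙⟨⟩-computes pair-computes x! y!))

□-vertexBitₚ : Prog n → Prog n → Prog n
□-vertexBitₚ x y = leftBitₚ (vertexIndexₚ x) ∧ₚ rightBitₚ (vertexIndexₚ y)

□-vertexBit-decides : ∀ {x f y g} → Computes {n} A x f → Computes A y g →
  Decides A (□-vertexBitₚ x y) (λ xs → □-vertexBit (left A) (right A) (f xs) (g xs))
□-vertexBit-decides x! y! =
  ∧-decides (leftBit-decides (vertexIndex-computes x!)) (rightBit-decides (vertexIndex-computes y!))

□-edgeBitₚ : (x y x′ y′ : Prog n) → Prog n
□-edgeBitₚ x y x′ y′ =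
  y ≡ᵇₚ y′ ∧ₚ rightBitₚ (vertexIndexₚ y) ∧ₚ leftBitₚ (edgeIndexₚ x x′) ∨ₚ
  x ≡ᵇₚ x′ ∧ₚ leftBitₚ (vertexIndexₚ x) ∧ₚ rightBitₚ (edgeIndexₚ y y′)

□-edgeBit-decides : ∀ {x f y g x′ f′ y′ g′} →
  Computes {n} A x f → Computes A y g → Computes A x′ f′ → Computes A y′ g′ →
  Decides A (□-edgeBitₚ x y x′ y′) (λ xs → □-edgeBit (left A) (right A) (f xs) (g xs) (f′ xs) (g′ xs))
□-edgeBit-decides x! y! x′! y′! =
  ∨-decides (∧-decides (≡ᵇ-decides y! y′!) (∧-decides (rightBit-decides (vertexIndex-computes y!))
                                                        (leftBit-decides (edgeIndex-computes x! x′!))))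
            (∧-decides (≡ᵇ-decides x! x′!) (∧-decides (leftBit-decides (vertexIndex-computes x!))
                                                        (rightBit-decides (edgeIndex-computes y! y′!))))

productₚ : Prog 1
productₚ = □-vertexBitₚ u₁ u₂
        ⊕ₚ □-edgeBitₚ (unpair₁ₚ ∙ u₁) (unpair₂ₚ ∙ u₁) (unpair₁ₚ ∙ u₂) (unpair₂ₚ ∙ u₂)
  where
  u₁ u₂ : Prog 1
  u₁ = unpair₁ₚ ∙ proj zero
  u₂ = unpair₂ₚ ∙ proj zero

product-decides : productₚ ⟦ A ⟧≡ (left A □ right A)
product-decides {A} = ⟦⟧≡-≗ (sym ∘ □-≗)
  (⊕-decides {X = □-vertexCode (left A) (right A)} {Y = □-edgeCode (left A) (right A)}
    (computes₁ (□-vertexBit-decides u₁! u₂!))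
    (computes₁ (□-edgeBit-decides (∙-computes unpair₁-computes u₁!) (∙-computes unpair₂-computes u₁!)
                                  (∙-computes unpair₁-computes u₂!) (∙-computes unpair₂-computes u₂!))))
  where
  u₁! = ∙-computes unpair₁-computes (proj-computes zero)
  u₂! = ∙-computes unpair₂-computes (proj-computes zero)

P≤sW⟨P,P⟩ : P ≤sW ⟨ P , P ⟩
P≤sW⟨P,P⟩ = orc ⊕ₚ orc , leftBitₚ (proj zero) , λ A A-graph →
  A ⊕ A , ⊕-decides orc-decides orc-decides ,
  (IsGraph-≗ (sym ∘ left-⊕ A A) A-graph , IsGraph-≗ (sym ∘ right-⊕ A A) A-graph) ,
  λ T (T₁-component , _) →
    left T , computes₁ (leftBit-decides (proj-computes zero)) ,
    IsComponent-≗ (left-⊕ A A) (λ _ → refl) T₁-component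

⟨P,P⟩≤sWP : ⟨ P , P ⟩ ≤sW P
⟨P,P⟩≤sWP = productₚ , slicesₚ , λ A (G-graph , H-graph) →
  left A □ right A , product-decides , □-isGraph G-graph H-graph ,
  λ C C-component →
    let (z , z-least@(z∈C , _)) = least-exists (proj₂ (proj₁ C-component)) in
    slices C z , slices-decides z-least , slices-isComponent C-component z∈C

theorem6p2 : P ≡sW ⟨ P , P ⟩
theorem6p2 = P≤sW⟨P,P⟩ , ⟨P,P⟩≤sWP
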